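{- Let $k\in\mathbb{N}$, let $\mathbf{X},\mathbf{A}$ be two finite $k$-enhanced $\sigma$-structures, and let $\xi:\mathbf{X}^{\otimes k}\to\mathbb{F}_{\mathscr{Q}_{\mathrm{conv}}}(\mathbf{A}^{\otimes k})$ be a homomorphism. Then $\xi(\mathbf{x}_{\mathbf{i}})(\mathbf{a}_{\mathbf{i}})=\xi(\mathbf{x})(\mathbf{a})$ for all $\mathbf{a}\in A^k$, $\mathbf{x}\in X^k$, $\mathbf{i}\in[k]^k$ such that $\mathbf{x}\prec\mathbf{a}$ and $\{\mathbf{x}_{\mathbf{i}}\}=\{\mathbf{x}\}$.
   Context: A $\sigma$-structure $\mathbf{A}$ has domain $A$ and relations $R^{\mathbf{A}}\subseteq A^{\mathrm{ar}(R)}$; homomorphisms preserve all relations coordinatewise. For $\mathbf{x}=(x_1,\dots,x_k)$ and $\mathbf{i}=(i_1,\dots,i_\ell)\in[k]^\ell$, $\mathbf{x}_{\mathbf{i}}=(x_{i_1},\dots,x_{i_\ell})$, and $\{\mathbf{x}\}=\{x_1,\dots,x_k\}$. For tuples $\mathbf{s}\in S^k$, $\mathbf{t}\in T^k$, $\mathbf{s}\prec\mathbf{t}$ means that $s_\alpha=s_\beta$ implies $t_\alpha=t_\beta$ for all $\alpha,\beta\in[k]$. A $\sigma$-structure is $k$-enhanced if $\sigma$ contains a $k$-ary symbol $R_k$ with $R_k^{\mathbf{A}}=A^k$. Tensor power: $\mathbf{A}^{\otimes k}$ has the same symbols, where $R$ of arity $r$ gets arity $r^k$ with positions indexed by $[r]^k$;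 domain $A^k$; $R^{\mathbf{A}^{\otimes k}}=\{\mathbf{a}^{\otimes k}:\mathbf{a}\in R^{\mathbf{A}}\}$ with $\mathbf{a}^{\otimes k}$ the family whose $\mathbf{i}$-th entry is $\mathbf{a}_{\mathbf{i}}\in A^k$. Maps are applied to such families entrywise. $\mathbb{F}_{\mathscr{Q}_{\mathrm{conv}}}(\mathbf{A}^{\otimes k})$: domain is the set of nonnegative rational tensors indexed by $A^k$ with entries summing to $1$ ($T(\mathbf{a})$ is the $\mathbf{a}$-entry); a family $(M_{\mathbf{i}})_{\mathbf{i}\in[r]^k}$ is in $R^{\mathbb{F}_{\mathscr{Q}_{\mathrm{conv}}}(\mathbf{A}^{\otimes k})}$ iff there is a rational probability vector $q$ on $R^{\mathbf{A}}$ with $M_{\mathbf{i}}(\mathbf{a})=\sum_{\mathbf{b}\in R^{\mathbf{A}},\,\mathbf{b}_{\mathbf{i}}=\mathbf{a}}q(\mathbf{b})$ for all $\mathbf{i}\in[r]^k$, $\mathbf{a}\in A^k$. -}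

module Defs where

open import Data.Nat using (ℕ; zero; suc)
open import Data.Fin using (Fin; zero; suc)
open import Data.Vec using (Vec; []; _∷_; map; lookup)
open import Data.Vec.Properties using (≡-dec)
open import Data.Fin.Properties using (_≟_)
open import Data.List using (List; length)
import Data.List as L
open import Data.List.Membership.Propositional using (_∈_)
open import Data.Vec.Membership.Propositional using () renaming (_∈_ to _∈ᵥ_)
open import Data.Rational using (ℚ; 0ℚ; 1ℚ; _+_; _≤_)
open import Data.Product using (Σ; _×_)
open import Relation.Binary.PropositionalEquality using (_≡_)
open import Relation.Nullary using (yes; no)

record Signature : Set₁ where
  field
    Sym : Set
    ar  : Sym → ℕ
open Signature public

record Structure (σ : Signature) : Set where
  field
    size : ℕ
    rel  : (R : Sym σ) → List (Vec (Fin size) (ar σ R))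
open Structure public

_at_ : ∀ {A : Set} {k ℓ} → Vec A k → Vec (Fin k) ℓ → Vec A ℓ
x at i = map (lookup x) i

_≺_ : ∀ {S T : Set} {k} → Vec S k → Vec T k → Set
_≺_ {k = k} s t = ∀ (α β : Fin k) → lookup s α ≡ lookup s β → lookup t α ≡ lookup t β

SameSet : ∀ {S : Set} {k ℓ} → Vec S k → Vec S ℓ → Set
SameSet {S} x y = ∀ (z : S) → (z ∈ᵥ x → z ∈ᵥ y) × (z ∈ᵥ y → z ∈ᵥ x)

-- the structure has the symbol Rk as a k-ary symbol interpreted as A^k
-- (Rk is a fixed designated symbol of σ, shared by all structures)
FullRel : ∀ {σ} (k : ℕ) (Rk : Sym σ) (A : Structure σ) → Set
FullRel {σ} k Rk A = (ar σ Rk ≡ k) × (∀ (t : Vec (Fin (size A)) (ar σ Rk)) → t ∈ rel A Rk)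

sumFin : (n : ℕ) → (Fin n → ℚ) → ℚ
sumFin zero    f = 0ℚ
sumFin (suc n) f = f zero + sumFin n (λ j → f (suc j))

sumVecs : (n k : ℕ) → (Vec (Fin n) k → ℚ) → ℚ
sumVecs n zero    f = f []
sumVecs n (suc k) f = sumFin n (λ a → sumVecs n k (λ t → f (a ∷ t)))

-- domain of F_{Q_conv}(A^{⊗k}): nonnegative rational tensors indexed by A^k summing to 1
record Tensor (n k : ℕ) : Set where
  field
    entry  : Vec (Fin n) k → ℚ
    nonneg : ∀ a → 0ℚ ≤ entry a
    total  : sumVecs n k entry ≡ 1ℚ
open Tensor public

record ProbOn {B : Set} (l : List B) : Set where
  field
    q      : Fin (length l) → ℚ
    qnonneg : ∀ p → 0ℚ ≤ q p
    qtotal  : sumFin (length l) q ≡ 1ℚ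
open ProbOn public

marginal : ∀ {n r k} (l : List (Vec (Fin n) r)) → ProbOn l → Vec (Fin r) k → Vec (Fin n) k → ℚ
marginal l Q i a = sumFin (length l) (λ p → cond (≡-dec _≟_ (L.lookup l p at i) a) (q Q p))
  where
  cond : ∀ {P : Set} → Relation.Nullary.Dec P → ℚ → ℚ
  cond (yes _) v = v
  cond (no _)  v = 0ℚ

FreeRel : ∀ {σ} (A : Structure σ) (k : ℕ) (R : Sym σ)
          → (Vec (Fin (ar σ R)) k → Tensor (size A) k) → Set
FreeRel {σ} A k R M =
  Σ (ProbOn (rel A R)) λ Q →
    ∀ (i : Vec (Fin (ar σ R)) k) (a : Vec (Fin (size A)) k) →
      entry (M i) a ≡ marginal (rel A R) Q i a

-- homomorphism X^{⊗k} → F_{Q_conv}(A^{⊗k}): for every x ∈ R^X, the family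
-- x^{⊗k} = (x_i)_{i ∈ [r]^k} is mapped entrywise into R^F.
IsHomTensorFree : ∀ {σ} (k : ℕ) (X A : Structure σ)
                  → (Vec (Fin (size X)) k → Tensor (size A) k) → Set
IsHomTensorFree {σ} k X A ξ =
  ∀ (R : Sym σ) (x : Vec (Fin (size X)) (ar σ R)) → x ∈ rel X R →
    FreeRel A k R (λ i → ξ (x at i))

{-# OPTIONS --safe #-}
-- Since X is k-enhanced, ξ maps the whole family (x_j)_{j ∈ [k]^k} into the
-- k-ary full relation, so a single probability vector q on R_k^A realises every
-- ξ(x_j) as the j-marginal of q. Marginals at j and j' coincide whenever
-- x_j = x_{j'}. Taking j to identify two coordinates α, β with x_α = x_β shows
-- that every tuple b in the support of q satisfies b_α = b_β, i.e. x ≺ b. For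
-- such b, and for a with x ≺ a, the condition {x_i} = {x} makes b_i = a_i
-- equivalent to b = a, so the i-marginal at a_i equals the identity marginal at a.
module Submission where

open import Defs
open import Data.Nat using (ℕ; zero; suc)
open import Data.Fin using (Fin; zero; suc)
import Data.Fin.Properties as Fin
open import Data.Vec using (Vec; lookup; allFin; _[_]≔_)
open import Data.Vec.Properties
  using (≡-dec; lookup-map; map-lookup-allFin; map-[]≔; []≔-lookup;
         lookup∘update; lookup∘update′; tabulate∘lookup; tabulate-cong)
open import Data.Vec.Relation.Unary.Any using (index)
open import Data.Vec.Relation.Unary.Any.Properties using (lookup-index)
open import Data.Vec.Membership.Propositional using () renaming (_∈_ to _∈ᵥ_)
open import Data.Vec.Membership.Propositional.Properties using (∈-lookup)
open import Data.List using (List; length)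
import Data.List as List
open import Data.Rational using (ℚ; 0ℚ; _+_; _≤_; _≟_)
open import Data.Rational.Properties
  using (≤-refl; ≤-antisym; +-identityˡ; +-identityʳ; +-mono-≤; +-monoˡ-≤; +-monoʳ-≤; module ≤-Reasoning)
open import Data.Product using (Σ; _,_; proj₁; proj₂)
open import Data.Empty using (⊥-elim)
open import Function using (_∘_; _⇔_; mk⇔; Equivalence)
open import Relation.Binary.PropositionalEquality
open import Relation.Nullary using (Dec; yes; no; ¬_)

sumFin-cong : ∀ n {f g : Fin n → ℚ} → (∀ p → f p ≡ g p) → sumFin n f ≡ sumFin n g
sumFin-cong zero    f≗g = refl
sumFin-cong (suc n) f≗g = cong₂ _+_ (f≗g zero) (sumFin-cong n (f≗g ∘ suc))

sumFin-≡0 : ∀ n (f : Fin n → ℚ) → (∀ p → f p ≡ 0ℚ) → sumFin n f ≡ 0ℚ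
sumFin-≡0 zero    f f≡0 = refl
sumFin-≡0 (suc n) f f≡0 =
  trans (cong₂ _+_ (f≡0 zero) (sumFin-≡0 n (f ∘ suc) (f≡0 ∘ suc))) (+-identityʳ 0ℚ)

sumFin-nonneg : ∀ n (f : Fin n → ℚ) → (∀ p → 0ℚ ≤ f p) → 0ℚ ≤ sumFin n f
sumFin-nonneg zero    f f≥0 = ≤-refl
sumFin-nonneg (suc n) f f≥0 = subst (_≤ sumFin (suc n) f) (+-identityʳ 0ℚ)
  (+-mono-≤ (f≥0 zero) (sumFin-nonneg n (f ∘ suc) (f≥0 ∘ suc)))

term≤sumFin : ∀ n (f : Fin n → ℚ) → (∀ p → 0ℚ ≤ f p) → ∀ p → f p ≤ sumFin n f
term≤sumFin (suc n) f f≥0 zero = begin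
  f zero                 ≡⟨ sym (+-identityʳ (f zero)) ⟩
  f zero + 0ℚ            ≤⟨ +-monoʳ-≤ (f zero) (sumFin-nonneg n (f ∘ suc) (f≥0 ∘ suc)) ⟩
  sumFin (suc n) f       ∎
  where open ≤-Reasoning
term≤sumFin (suc n) f f≥0 (suc p) = begin
  f (suc p)                       ≤⟨ term≤sumFin n (f ∘ suc) (f≥0 ∘ suc) p ⟩
  sumFin n (f ∘ suc)              ≡⟨ sym (+-identityˡ _) ⟩
  0ℚ + sumFin n (f ∘ suc)         ≤⟨ +-monoˡ-≤ (sumFin n (f ∘ suc)) (f≥0 zero) ⟩
  sumFin (suc n) f                ∎
  where open ≤-Reasoning

[_]*_ : ∀ {P : Set} → Dec P → ℚ → ℚ
[ yes _ ]* v = v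
[ no _ ]*  v = 0ℚ

[]*-nonneg : ∀ {P : Set} (d : Dec P) {v} → 0ℚ ≤ v → 0ℚ ≤ [ d ]* v
[]*-nonneg (yes _) v≥0 = v≥0
[]*-nonneg (no _)  v≥0 = ≤-refl

[]*-yes : ∀ {P : Set} (d : Dec P) v → P → [ d ]* v ≡ v
[]*-yes (yes _) v p = refl
[]*-yes (no ¬p) v p = ⊥-elim (¬p p)

[]*-no : ∀ {P : Set} (d : Dec P) v → ¬ P → [ d ]* v ≡ 0ℚ
[]*-no (yes p) v ¬p = ⊥-elim (¬p p)
[]*-no (no _)  v ¬p = refl

[]*-zero : ∀ {P : Set} (d : Dec P) → [ d ]* 0ℚ ≡ 0ℚ
[]*-zero (yes _) = refl
[]*-zero (no _)  = refl

[]*-cong : ∀ {P P′ : Set} (d : Dec P) (d′ : Dec P′) v → P ⇔ P′ → [ d ]* v ≡ [ d′ ]* v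
[]*-cong (yes _) (yes _)  v P⇔P′ = refl
[]*-cong (yes p) (no ¬p′) v P⇔P′ = ⊥-elim (¬p′ (Equivalence.to P⇔P′ p))
[]*-cong (no ¬p) (yes p′) v P⇔P′ = ⊥-elim (¬p (Equivalence.from P⇔P′ p′))
[]*-cong (no _)  (no _)   v P⇔P′ = refl

module _ {n r k : ℕ} (l : List (Vec (Fin n) r)) (Q : ProbOn l) where

  private
    b : Fin (length l) → Vec (Fin n) r
    b = List.lookup l

    hits : Vec (Fin r) k → Vec (Fin n) k → Fin (length l) → ℚ
    hits j c p = [ ≡-dec Fin._≟_ (b p at j) c ]* q Q p

  -- The summand of marginal is local to Defs, so it is captured by unification.
  marginal≡sum-hits : ∀ j c → marginal l Q j c ≡ sumFin (length l) (hits j c)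
  marginal≡sum-hits j c = trans (proj₂ unfolded) (sumFin-cong (length l) summand≡hits)
    where
    unfolded : Σ (Fin (length l) → ℚ) λ f → marginal l Q j c ≡ sumFin (length l) f
    unfolded = _ , refl
    summand≡hits : ∀ p → proj₁ unfolded p ≡ hits j c p
    summand≡hits p with ≡-dec Fin._≟_ (b p at j) c
    ... | yes _ = refl
    ... | no _  = refl

  marginal-≡0 : ∀ j c → (∀ p → b p at j ≢ c) → marginal l Q j c ≡ 0ℚ
  marginal-≡0 j c miss = trans (marginal≡sum-hits j c)
    (sumFin-≡0 (length l) (hits j c) λ p → []*-no (≡-dec Fin._≟_ (b p at j) c) (q Q p) (miss p))

  q≤marginal : ∀ j p → q Q p ≤ marginal l Q j (b p at j)
  q≤marginal j p = subst₂ _≤_ ([]*-yes (≡-dec Fin._≟_ (b p at j) (b p at j)) (q Q p) refl)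
    (sym (marginal≡sum-hits j (b p at j)))
    (term≤sumFin (length l) (hits j (b p at j)) (λ p′ → []*-nonneg (≡-dec Fin._≟_ (b p′ at j) (b p at j)) (qnonneg Q p′)) p)

  marginal-cong : ∀ j c j′ c′ → (∀ p → q Q p ≢ 0ℚ → (b p at j ≡ c) ⇔ (b p at j′ ≡ c′))
                → marginal l Q j c ≡ marginal l Q j′ c′
  marginal-cong j c j′ c′ agree = begin
    marginal l Q j c                ≡⟨ marginal≡sum-hits j c ⟩
    sumFin (length l) (hits j c)    ≡⟨ sumFin-cong (length l) hits≡ ⟩
    sumFin (length l) (hits j′ c′)  ≡⟨ sym (marginal≡sum-hits j′ c′) ⟩
    marginal l Q j′ c′              ∎
    where
    open ≡-Reasoning
    hits≡ : ∀ p → hits j c p ≡ hits j′ c′ p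
    hits≡ p with ≡-dec Fin._≟_ (b p at j) c | ≡-dec Fin._≟_ (b p at j′) c′ | q Q p ≟ 0ℚ
    ... | d | d′ | yes q≡0 = trans (cong [ d ]*_ q≡0) (trans ([]*-zero d) (sym (trans (cong [ d′ ]*_ q≡0) ([]*-zero d′))))
    ... | d | d′ | no q≢0  = []*-cong d d′ (q Q p) (agree p q≢0)

vec-ext : ∀ {S : Set} {k} (u v : Vec S k) → (∀ γ → lookup u γ ≡ lookup v γ) → u ≡ v
vec-ext u v u≗v = trans (sym (tabulate∘lookup u)) (trans (tabulate-cong u≗v) (tabulate∘lookup v))

lookup-at : ∀ {S : Set} {k ℓ} (v : Vec S k) (j : Vec (Fin k) ℓ) γ → lookup (v at j) γ ≡ lookup v (lookup j γ)
lookup-at v j γ = lookup-map γ (lookup v) j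

identify : ∀ {k} → Fin k → Fin k → Vec (Fin k) k
identify {k} β α = allFin k [ β ]≔ α

at-identify : ∀ {S : Set} {k} (v : Vec S k) (β α : Fin k) → v at identify β α ≡ v [ β ]≔ lookup v α
at-identify v β α = trans (map-[]≔ (lookup v) (allFin _) β) (cong (_[ β ]≔ lookup v α) (map-lookup-allFin v))

at-identify-id : ∀ {S : Set} {k} (v : Vec S k) (β α : Fin k) → lookup v β ≡ lookup v α → v at identify β α ≡ v
at-identify-id v β α vβ≡vα = begin
  v at identify β α        ≡⟨ at-identify v β α ⟩
  v [ β ]≔ lookup v α      ≡⟨ cong (v [ β ]≔_) (sym vβ≡vα) ⟩
  v [ β ]≔ lookup v β      ≡⟨ []≔-lookup v β ⟩
  v                        ∎
  where open ≡-Reasoning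

at-identify-merges : ∀ {S : Set} {k} (v : Vec S k) (β α : Fin k)
                   → lookup (v at identify β α) α ≡ lookup (v at identify β α) β
at-identify-merges v β α rewrite at-identify v β α with α Fin.≟ β
... | yes refl = refl
... | no α≢β  = trans (lookup∘update′ α≢β v (lookup v α)) (sym (lookup∘update β v (lookup v α)))

≺-at-injective : ∀ {S T : Set} {k ℓ} {x : Vec S k} {a b : Vec T k} (i : Vec (Fin k) ℓ)
               → x ≺ a → x ≺ b → (∀ z → z ∈ᵥ x → z ∈ᵥ x at i) → b at i ≡ a at i → b ≡ a
≺-at-injective {x = x} {a} {b} i x≺a x≺b x⊆xi bi≡ai = vec-ext b a λ α →
  let xα∈xi = x⊆xi (lookup x α) (∈-lookup α x)
      γ      = index xα∈xi
      δ      = lookup i γ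
      xδ≡xα  = trans (sym (lookup-at x i γ)) (sym (lookup-index xα∈xi))
  in begin
    lookup b α          ≡⟨ sym (x≺b δ α xδ≡xα) ⟩
    lookup b δ          ≡⟨ sym (lookup-at b i γ) ⟩
    lookup (b at i) γ   ≡⟨ cong (λ v → lookup v γ) bi≡ai ⟩
    lookup (a at i) γ   ≡⟨ lookup-at a i γ ⟩
    lookup a δ          ≡⟨ x≺a δ α xδ≡xα ⟩
    lookup a α          ∎
  where open ≡-Reasoning

Marginals : ∀ {nX nA r k} → (Vec (Fin nX) k → Tensor nA k) → Vec (Fin nX) r
          → (l : List (Vec (Fin nA) r)) → ProbOn l → Set
Marginals {r = r} {k} ξ x l Q = ∀ (j : Vec (Fin r) k) c → entry (ξ (x at j)) c ≡ marginal l Q j c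

module _ {nX nA k : ℕ} (ξ : Vec (Fin nX) k → Tensor nA k) (x : Vec (Fin nX) k)
         (l : List (Vec (Fin nA) k)) (Q : ProbOn l) (ξ≡marginal : Marginals ξ x l Q) where

  marginal-respects : ∀ {j j′} → x at j ≡ x at j′ → ∀ c → marginal l Q j c ≡ marginal l Q j′ c
  marginal-respects {j} {j′} xj≡xj′ c = begin
    marginal l Q j c          ≡⟨ sym (ξ≡marginal j c) ⟩
    entry (ξ (x at j)) c      ≡⟨ cong (λ y → entry (ξ y) c) xj≡xj′ ⟩
    entry (ξ (x at j′)) c     ≡⟨ ξ≡marginal j′ c ⟩
    marginal l Q j′ c         ∎
    where open ≡-Reasoning

  support-≺ : ∀ p → q Q p ≢ 0ℚ → x ≺ List.lookup l p
  support-≺ p q≢0 α β xα≡xβ with lookup (List.lookup l p) α Fin.≟ lookup (List.lookup l p) β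
  ... | yes bα≡bβ = bα≡bβ
  ... | no bα≢bβ  = ⊥-elim (q≢0 (≤-antisym q≤0 (qnonneg Q p)))
    where
    bp = List.lookup l p
    j  = identify β α
    xj≡x : x at j ≡ x at allFin k
    xj≡x = trans (at-identify-id x β α (sym xα≡xβ)) (sym (map-lookup-allFin x))
    miss : ∀ p′ → List.lookup l p′ at j ≢ bp
    miss p′ e = bα≢bβ (trans (cong (λ v → lookup v α) (sym e))
                        (trans (at-identify-merges (List.lookup l p′) β α) (cong (λ v → lookup v β) e)))
    q≤0 : q Q p ≤ 0ℚ
    q≤0 = begin
      q Q p                                ≤⟨ q≤marginal l Q (allFin k) p ⟩
      marginal l Q (allFin k) (bp at allFin k) ≡⟨ cong (marginal l Q (allFin k)) (map-lookup-allFin bp) ⟩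
      marginal l Q (allFin k) bp           ≡⟨ sym (marginal-respects xj≡x bp) ⟩
      marginal l Q j bp                    ≡⟨ marginal-≡0 l Q j bp miss ⟩
      0ℚ                                   ∎
      where open ≤-Reasoning

  entry-reindex-invariant : ∀ (a : Vec (Fin nA) k) (i : Vec (Fin k) k) → x ≺ a → SameSet (x at i) x
                         → entry (ξ (x at i)) (a at i) ≡ entry (ξ x) a
  entry-reindex-invariant a i x≺a same = begin
    entry (ξ (x at i)) (a at i)       ≡⟨ ξ≡marginal i (a at i) ⟩
    marginal l Q i (a at i)           ≡⟨ marginal-cong l Q i (a at i) (allFin k) a agree ⟩
    marginal l Q (allFin k) a         ≡⟨ sym (ξ≡marginal (allFin k) a) ⟩
    entry (ξ (x at allFin k)) a       ≡⟨ cong (λ y → entry (ξ y) a) (map-lookup-allFin x) ⟩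
    entry (ξ x) a                     ∎
    where
    open ≡-Reasoning
    agree : ∀ p → q Q p ≢ 0ℚ → (List.lookup l p at i ≡ a at i) ⇔ (List.lookup l p at allFin k ≡ a)
    agree p q≢0 = mk⇔
      (λ bi≡ai → trans (map-lookup-allFin _) (≺-at-injective {x = x} {a} {List.lookup l p} i x≺a (support-≺ p q≢0) (λ z → proj₂ (same z)) bi≡ai))
      (λ b≡a → cong (_at i) (trans (sym (map-lookup-allFin (List.lookup l p))) b≡a))

lemma4p6 : (σ : Signature) (k : ℕ) (Rk : Sym σ) (X A : Structure σ)
    → FullRel k Rk X → FullRel k Rk A
    → (ξ : Vec (Fin (size X)) k → Tensor (size A) k) → IsHomTensorFree k X A ξ
    → ∀ (a : Vec (Fin (size A)) k) (x : Vec (Fin (size X)) k) (i : Vec (Fin k) k)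
    → x ≺ a → SameSet (x at i) x
    → entry (ξ (x at i)) (a at i) ≡ entry (ξ x) a
lemma4p6 σ k Rk X A (ar≡k , full) _ ξ hom a x i =
  reindex (ar σ Rk) ar≡k (rel A Rk) (λ x′ → hom Rk x′ (full x′))
  where
  reindex : ∀ r → r ≡ k → (l : List (Vec (Fin (size A)) r))
          → (∀ (x′ : Vec (Fin (size X)) r) → Σ (ProbOn l) (Marginals ξ x′ l))
          → x ≺ a → SameSet (x at i) x → entry (ξ (x at i)) (a at i) ≡ entry (ξ x) a
  reindex r refl l realised = entry-reindex-invariant ξ x l (proj₁ (realised x)) (proj₂ (realised x)) a i
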